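{- Let $X$ be an $n\times n$ Boolean matrix with $X=X^*$, let $i\in\{1,\dots,n\}$, and let $\Delta X$ be an $n\times n$ Boolean matrix that is $i$-transitive and $i$-complete with respect to $X$. Then $X+\Delta X=(X+I_{\Delta X,i}+J_{\Delta X,i})^2$.
   Context: Boolean matrices are added and multiplied in the Boolean semiring ($+$ is entrywise OR, product is Boolean matrix product); $X^*=\sum_{t\ge0}X^t$ with $X^0$ the identity. For a matrix $Z$ and index $i$, $I_{Z,i}$ is the matrix equal to $Z$ in row $i$ and $0$ elsewhere, and $J_{Z,i}$ is the matrix equal to $Z$ in column $i$ and $0$ elsewhere. $\Delta X$ is $i$-transitive with respect to $X$ if $I_{\Delta X,i}=I_{\Delta X,i}\cdot X$ and $J_{\Delta X,i}=X\cdot J_{\Delta X,i}$. $\Delta X$ is $i$-complete with respect to $X$ if $\Delta X=J_{\Delta X,i}\cdot I_{\Delta X,i}+X\cdot I_{\Delta X,i}+J_{\Delta X,i}\cdot X$. -}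

module Defs where

open import Data.Bool using (Bool; true; false; _∨_; _∧_)
open import Data.Nat using (ℕ; zero; suc)
open import Data.Fin using (Fin; _≟_)
open import Data.Product using (∃; _×_)
open import Relation.Binary.PropositionalEquality using (_≡_)
open import Relation.Nullary.Decidable using (does)

Mat : ℕ → Set
Mat n = Fin n → Fin n → Bool

any : ∀ {n} → (Fin n → Bool) → Bool
any {zero}  f = false
any {suc n} f = f Fin.zero ∨ any {n} (λ k → f (Fin.suc k))

_⊕_ : ∀ {n} → Mat n → Mat n → Mat n
(A ⊕ B) i j = A i j ∨ B i j

_⊗_ : ∀ {n} → Mat n → Mat n → Mat n
(A ⊗ B) i j = any (λ k → A i k ∧ B k j)

infixl 6 _⊕_
infixl 7 _⊗_

𝟙 : ∀ {n} → Mat n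
𝟙 i j = does (i ≟ j)

_^_ : ∀ {n} → Mat n → ℕ → Mat n
X ^ zero  = 𝟙
X ^ suc t = (X ^ t) ⊗ X

-- X = X* where X* = Σ_{t ≥ 0} X^t (infinite Boolean sum): entry (i,j) of X*
-- is true iff some X^t has a true entry at (i,j).
IsStarClosed : ∀ {n} → Mat n → Set
IsStarClosed X = ∀ i j → (X i j ≡ true → ∃ λ t → (X ^ t) i j ≡ true)
                       × ((∃ λ t → (X ^ t) i j ≡ true) → X i j ≡ true)

Irow : ∀ {n} → Mat n → Fin n → Mat n
Irow Z i r c = does (r ≟ i) ∧ Z r c

Jcol : ∀ {n} → Mat n → Fin n → Mat n
Jcol Z i r c = does (c ≟ i) ∧ Z r c

_≐_ : ∀ {n} → Mat n → Mat n → Set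
A ≐ B = ∀ r c → A r c ≡ B r c

IsTransitive : ∀ {n} → Fin n → Mat n → Mat n → Set
IsTransitive i X ΔX = (Irow ΔX i ≐ (Irow ΔX i ⊗ X)) × (Jcol ΔX i ≐ (X ⊗ Jcol ΔX i))

IsComplete : ∀ {n} → Fin n → Mat n → Mat n → Set
IsComplete i X ΔX =
  ΔX ≐ (Jcol ΔX i ⊗ Irow ΔX i ⊕ X ⊗ Irow ΔX i ⊕ Jcol ΔX i ⊗ X)

-- Read A = X + I + J as a graph whose edges are those of X, of row i of ΔX and
-- of column i of ΔX.  Every two-step path of A lands in X + ΔX: X is reflexive
-- and transitive since X = X*, i-transitivity absorbs an X-step into row i or
-- column i of ΔX, and the remaining paths have the shape J·I, X·I or J·X, which
-- i-completeness puts into ΔX.  Conversely, completeness writes ΔX as such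
-- paths, and X ⊆ X·X by reflexivity.
module Submission where

open import Defs
open import Data.Nat using (ℕ; zero; suc)
open import Data.Fin using (Fin; _≟_)
open import Data.Bool using (Bool; true; false; _∨_; _∧_)
open import Data.Bool.Properties using (⇔→≡)
open import Data.Product using (∃; _×_; _,_; proj₁; proj₂)
open import Data.Sum using (_⊎_; inj₁; inj₂)
open import Function.Bundles using (mk⇔)
open import Relation.Nullary using (yes)
open import Relation.Nullary.Decidable using (dec-true)
open import Relation.Binary.PropositionalEquality using (_≡_; refl; sym; trans)

∨-true⁻ : ∀ a {b} → a ∨ b ≡ true → a ≡ true ⊎ b ≡ true
∨-true⁻ true  _ = inj₁ refl
∨-true⁻ false p = inj₂ p

∨-trueˡ : ∀ {a} b → a ≡ true → a ∨ b ≡ true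
∨-trueˡ b refl = refl

∨-trueʳ : ∀ a {b} → b ≡ true → a ∨ b ≡ true
∨-trueʳ true  _ = refl
∨-trueʳ false p = p

∧-true : ∀ {a b} → a ≡ true → b ≡ true → a ∧ b ≡ true
∧-true refl refl = refl

∧-true⁻ : ∀ a {b} → a ∧ b ≡ true → a ≡ true × b ≡ true
∧-true⁻ true p = refl , p

any-true : ∀ {n} (f : Fin n → Bool) k → f k ≡ true → any f ≡ true
any-true f Fin.zero    p = ∨-trueˡ _ p
any-true f (Fin.suc k) p = ∨-trueʳ (f Fin.zero) (any-true (λ k → f (Fin.suc k)) k p)

any-true⁻ : ∀ {n} (f : Fin n → Bool) → any f ≡ true → ∃ λ k → f k ≡ true
any-true⁻ {zero}  f ()
any-true⁻ {suc n} f p with ∨-true⁻ (f Fin.zero) p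
... | inj₁ q = Fin.zero , q
... | inj₂ q with any-true⁻ (λ k → f (Fin.suc k)) q
...   | k , r = Fin.suc k , r

infix 4 _⊆_

_⊆_ : ∀ {n} → Mat n → Mat n → Set
A ⊆ B = ∀ r c → A r c ≡ true → B r c ≡ true

⊆-antisym : ∀ {n} {A B : Mat n} → A ⊆ B → B ⊆ A → A ≐ B
⊆-antisym A⊆B B⊆A r c = ⇔→≡ (mk⇔ (A⊆B r c) (B⊆A r c))

⊕-upperˡ : ∀ {n} (A B : Mat n) → A ⊆ A ⊕ B
⊕-upperˡ A B r c p = ∨-trueˡ (B r c) p

⊕-upperʳ : ∀ {n} (A B : Mat n) → B ⊆ A ⊕ B
⊕-upperʳ A B r c p = ∨-trueʳ (A r c) p

⊕-lub : ∀ {n} {A B C : Mat n} → A ⊆ C → B ⊆ C → A ⊕ B ⊆ C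
⊕-lub {A = A} A⊆C B⊆C r c p with ∨-true⁻ (A r c) p
... | inj₁ q = A⊆C r c q
... | inj₂ q = B⊆C r c q

⊆-trans : ∀ {n} {A B C : Mat n} → A ⊆ B → B ⊆ C → A ⊆ C
⊆-trans A⊆B B⊆C r c p = B⊆C r c (A⊆B r c p)

⊗-true : ∀ {n} (A B : Mat n) {r k c} → A r k ≡ true → B k c ≡ true → (A ⊗ B) r c ≡ true
⊗-true A B {k = k} p q = any-true _ k (∧-true p q)

⊗-true⁻ : ∀ {n} (A B : Mat n) {r c} → (A ⊗ B) r c ≡ true
        → ∃ λ k → A r k ≡ true × B k c ≡ true
⊗-true⁻ A B {r} p with any-true⁻ _ p
... | k , q = k , ∧-true⁻ (A r k) q

⊗-mono : ∀ {n} {A A′ B B′ : Mat n} → A ⊆ A′ → B ⊆ B′ → A ⊗ B ⊆ A′ ⊗ B′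
⊗-mono {A = A} {A′} {B} {B′} A⊆A′ B⊆B′ r c p with ⊗-true⁻ A B p
... | k , q , s = ⊗-true A′ B′ (A⊆A′ r k q) (B⊆B′ k c s)

𝟙-diagonal : ∀ {n} (r : Fin n) → 𝟙 r r ≡ true
𝟙-diagonal r = dec-true (r ≟ r) refl

Irow-true : ∀ {n} (Z : Mat n) i {c} → Z i c ≡ true → Irow Z i i c ≡ true
Irow-true Z i p = ∧-true (𝟙-diagonal i) p

Irow-true⁻ : ∀ {n} (Z : Mat n) i {r c} → Irow Z i r c ≡ true → r ≡ i × Z r c ≡ true
Irow-true⁻ Z i {r} p with r ≟ i
... | yes r≡i = r≡i , p

Jcol-true : ∀ {n} (Z : Mat n) i {r} → Z r i ≡ true → Jcol Z i r i ≡ true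
Jcol-true Z i p = ∧-true (𝟙-diagonal i) p

Jcol-true⁻ : ∀ {n} (Z : Mat n) i {r c} → Jcol Z i r c ≡ true → c ≡ i × Z r c ≡ true
Jcol-true⁻ Z i {c = c} p with c ≟ i
... | yes c≡i = c≡i , p

module _ {n} {X : Mat n} (star : IsStarClosed X) where

  star-reflexive : ∀ r → X r r ≡ true
  star-reflexive r = proj₂ (star r r) (0 , 𝟙-diagonal r)

  star-transitive : ∀ {r k c} → X r k ≡ true → X k c ≡ true → X r c ≡ true
  star-transitive {r} {c = c} p q =
    proj₂ (star r c) (2 , ⊗-true (𝟙 ⊗ X) X {r} (⊗-true 𝟙 X {r} {r} (𝟙-diagonal r) p) q)

  star-⊆-square : X ⊆ X ⊗ X
  star-⊆-square r c p = ⊗-true X X (star-reflexive r) p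

module _ {n} {X ΔX : Mat n} {i : Fin n} where

  private
    I = Irow ΔX i
    J = Jcol ΔX i
    A = X ⊕ I ⊕ J

    inX : ∀ {r c} → X r c ≡ true → (X ⊕ ΔX) r c ≡ true
    inX {r} {c} = ⊕-upperˡ X ΔX r c

    inΔX : ∀ {r c} → ΔX r c ≡ true → (X ⊕ ΔX) r c ≡ true
    inΔX {r} {c} = ⊕-upperʳ X ΔX r c

  module _ (transitive : IsTransitive i X ΔX) where

    row-absorbs : ∀ {k c} → ΔX i k ≡ true → X k c ≡ true → ΔX i c ≡ true
    row-absorbs {c = c} p q =
      proj₂ (Irow-true⁻ ΔX i (trans (proj₁ transitive i c) (⊗-true I X (Irow-true ΔX i p) q)))

    column-absorbs : ∀ {r k} → X r k ≡ true → ΔX k i ≡ true → ΔX r i ≡ true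
    column-absorbs {r} p q =
      proj₂ (Jcol-true⁻ ΔX i (trans (proj₂ transitive r i) (⊗-true X J p (Jcol-true ΔX i q))))

  module _ (complete : IsComplete i X ΔX) where

    complete-JI : ∀ {r c} → ΔX r i ≡ true → ΔX i c ≡ true → ΔX r c ≡ true
    complete-JI {r} {c} p q = trans (complete r c)
      (∨-trueˡ ((J ⊗ X) r c) (∨-trueˡ ((X ⊗ I) r c)
        (⊗-true J I (Jcol-true ΔX i p) (Irow-true ΔX i q))))

    complete-XI : ∀ {r c} → X r i ≡ true → ΔX i c ≡ true → ΔX r c ≡ true
    complete-XI {r} {c} p q = trans (complete r c)
      (∨-trueˡ ((J ⊗ X) r c) (∨-trueʳ ((J ⊗ I) r c) (⊗-true X I p (Irow-true ΔX i q))))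

    complete-JX : ∀ {r c} → ΔX r i ≡ true → X i c ≡ true → ΔX r c ≡ true
    complete-JX {r} {c} p q = trans (complete r c)
      (∨-trueʳ ((J ⊗ I ⊕ X ⊗ I) r c) (⊗-true J X (Jcol-true ΔX i p) q))

    X⊕ΔX⊆square : IsStarClosed X → X ⊕ ΔX ⊆ A ⊗ A
    X⊕ΔX⊆square star =
      ⊕-lub (⊆-trans (star-⊆-square star) (⊗-mono X⊆A X⊆A))
            (⊆-trans ΔX⊆paths paths⊆square)
      where
      X⊆A : X ⊆ A
      X⊆A = ⊆-trans (⊕-upperˡ X I) (⊕-upperˡ (X ⊕ I) J)
      I⊆A : I ⊆ A
      I⊆A = ⊆-trans (⊕-upperʳ X I) (⊕-upperˡ (X ⊕ I) J)
      J⊆A : J ⊆ A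
      J⊆A = ⊕-upperʳ (X ⊕ I) J

      ΔX⊆paths : ΔX ⊆ J ⊗ I ⊕ X ⊗ I ⊕ J ⊗ X
      ΔX⊆paths r c p = trans (sym (complete r c)) p

      paths⊆square : J ⊗ I ⊕ X ⊗ I ⊕ J ⊗ X ⊆ A ⊗ A
      paths⊆square =
        ⊕-lub (⊕-lub (⊗-mono J⊆A I⊆A) (⊗-mono X⊆A I⊆A)) (⊗-mono J⊆A X⊆A)

  data Edge : Fin n → Fin n → Set where
    X-edge      : ∀ {a b} → X a b ≡ true → Edge a b
    row-edge    : ∀ {b} → ΔX i b ≡ true → Edge i b
    column-edge : ∀ {a} → ΔX a i ≡ true → Edge a i

  toEdge : ∀ {a b} → A a b ≡ true → Edge a b
  toEdge {a} {b} p with ∨-true⁻ ((X ⊕ I) a b) p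
  ... | inj₁ q with ∨-true⁻ (X a b) q
  ...   | inj₁ x = X-edge x
  ...   | inj₂ q′ with Irow-true⁻ ΔX i q′
  ...     | refl , d = row-edge d
  toEdge p | inj₂ q with Jcol-true⁻ ΔX i q
  ...   | refl , d = column-edge d

  module _ (star : IsStarClosed X) (transitive : IsTransitive i X ΔX)
           (complete : IsComplete i X ΔX) where

    edge-pair⇒X⊕ΔX : ∀ {r k c} → Edge r k → Edge k c → (X ⊕ ΔX) r c ≡ true
    edge-pair⇒X⊕ΔX (X-edge p)      (X-edge q)      = inX (star-transitive star p q)
    edge-pair⇒X⊕ΔX (X-edge p)      (row-edge q)    = inΔX (complete-XI complete p q)
    edge-pair⇒X⊕ΔX (X-edge p)      (column-edge q) = inΔX (column-absorbs transitive p q)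
    edge-pair⇒X⊕ΔX (row-edge p)    (X-edge q)      = inΔX (row-absorbs transitive p q)
    edge-pair⇒X⊕ΔX (row-edge _)    (row-edge q)    = inΔX q
    edge-pair⇒X⊕ΔX (row-edge _)    (column-edge _) = inX (star-reflexive star i)
    edge-pair⇒X⊕ΔX (column-edge p) (X-edge q)      = inΔX (complete-JX complete p q)
    edge-pair⇒X⊕ΔX (column-edge p) (row-edge q)    = inΔX (complete-JI complete p q)
    edge-pair⇒X⊕ΔX (column-edge p) (column-edge _) = inΔX p

    square⊆X⊕ΔX : A ⊗ A ⊆ X ⊕ ΔX
    square⊆X⊕ΔX r c p with ⊗-true⁻ A A p
    ... | k , q , s = edge-pair⇒X⊕ΔX (toEdge q) (toEdge s)

lemma7 : (n : ℕ) (X ΔX : Mat n) (i : Fin n)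
    → IsStarClosed X
    → IsTransitive i X ΔX
    → IsComplete i X ΔX
    → (X ⊕ ΔX) ≐ ((X ⊕ Irow ΔX i ⊕ Jcol ΔX i) ⊗ (X ⊕ Irow ΔX i ⊕ Jcol ΔX i))
lemma7 n X ΔX i star transitive complete =
  ⊆-antisym (X⊕ΔX⊆square complete star) (square⊆X⊕ΔX star transitive complete)
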